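{- Let $G$ be a graph without isolated vertices and let $(C,H,R)$ be a crown decomposition of $G$. If $G$ is well covered, then $G[R]$ and $G[C\cup H]$ are well covered.
   Context: A graph is well covered if all its maximal independent sets have the same size (equivalently, all minimal vertex covers have the same size). A crown decomposition of a graph $G$ is a partition of $V(G)$ into three parts $C$, $H$, $R$ such that: $C$ is nonempty; $C$ is an independent set; there are no edges between $C$ and $R$; and the edges between $C$ and $H$ contain a matching of size $|H|$. $G[X]$ denotes the subgraph induced by $X$. -}

module Defs where

open import Data.Nat using (ℕ)
open import Data.Bool using (Bool; true; false)
open import Data.Fin using (Fin)
open import Data.Fin.Subset using (Subset; _∈_; _∉_; _⊆_; ∣_∣; ⊤; _∪_)
open import Data.Product using (Σ; ∃; ∃-syntax; _×_; _,_; proj₁; proj₂)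
open import Data.Sum using (_⊎_)
open import Data.List using (List; length; map)
open import Data.List.Relation.Unary.All using (All)
open import Data.List.Relation.Unary.Unique.Propositional using (Unique)
open import Relation.Nullary using (¬_)
open import Relation.Binary.PropositionalEquality using (_≡_)

record Graph (n : ℕ) : Set where
  field
    adj     : Fin n → Fin n → Bool
    adj-sym : ∀ u v → adj u v ≡ adj v u
    irrefl  : ∀ v → adj v v ≡ false

open Graph public

Adj : ∀ {n} → Graph n → Fin n → Fin n → Set
Adj G u v = adj G u v ≡ true

Independent : ∀ {n} → Graph n → Subset n → Set
Independent G S = ∀ u v → u ∈ S → v ∈ S → ¬ Adj G u v

-- S is a maximal independent set of the induced subgraph G[X]
-- (vertex set X, edges of G between vertices of X).
MaximalIndependentIn : ∀ {n} → Graph n → Subset n → Subset n → Set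
MaximalIndependentIn G X S =
  S ⊆ X × Independent G S ×
  (∀ T → S ⊆ T → T ⊆ X → Independent G T → T ≡ S)

WellCoveredOn : ∀ {n} → Graph n → Subset n → Set
WellCoveredOn G X = ∀ S T → MaximalIndependentIn G X S → MaximalIndependentIn G X T → ∣ S ∣ ≡ ∣ T ∣

WellCovered : ∀ {n} → Graph n → Set
WellCovered G = WellCoveredOn G ⊤

NoIsolatedVertices : ∀ {n} → Graph n → Set
NoIsolatedVertices G = ∀ v → ∃[ u ] Adj G v u

IsPartition₃ : ∀ {n} → Subset n → Subset n → Subset n → Set
IsPartition₃ {n} C H R = ∀ (v : Fin n) →
  (v ∈ C × v ∉ H × v ∉ R) ⊎ (v ∉ C × v ∈ H × v ∉ R) ⊎ (v ∉ C × v ∉ H × v ∈ R)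

IsMatchingBetween : ∀ {n} → Graph n → Subset n → Subset n → List (Fin n × Fin n) → Set
IsMatchingBetween G C H M =
  All (λ e → proj₁ e ∈ C × proj₂ e ∈ H × Adj G (proj₁ e) (proj₂ e)) M ×
  Unique (map proj₁ M) × Unique (map proj₂ M)

record CrownDecomposition {n} (G : Graph n) (C H R : Subset n) : Set where
  field
    partition   : IsPartition₃ C H R
    C-nonempty  : ∃[ v ] v ∈ C
    C-indep     : Independent G C
    no-C-R-edge : ∀ u v → u ∈ C → v ∈ R → ¬ Adj G u v
    matching    : ∃[ M ] (IsMatchingBetween G C H M × length M ≡ ∣ H ∣)

-- A maximal independent set S of G[R] becomes maximal in G after adding C:
-- C is independent, has no edges to R, and dominates H because the crown
-- matching saturates H. Hence |S| = |C ∪ S| − |C| is the same for every such S.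
-- In G[C ∪ H], an independent set T meets H in vertices whose matched partners
-- lie in C ∖ T, so |T| ≤ |C|. Conversely, if T is maximal, extend it to a
-- maximal independent set W of G; then W ∩ (C ∪ H) = T, and replacing T by C
-- inside W gives an independent set which extends to one of size |W|, so
-- |C| ≤ |T|. Thus every maximal independent set of G[C ∪ H] has exactly |C|
-- vertices.
module Submission where

open import Defs
open import Data.Nat using (ℕ; suc; _+_; _≤_; z≤n; s≤s)
open import Data.Nat.Properties
  using (+-suc; n≤1+n; ≤-reflexive; ≤-trans; ≤-antisym; <⇒≢; +-monoʳ-≤; +-cancelʳ-≤; +-cancelˡ-≡; module ≤-Reasoning)
open import Data.Bool using (true; false)
import Data.Bool.Properties as Bool
open import Data.Vec using ([]; _∷_; here; there)
open import Data.Fin using (Fin)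
open import Data.Fin.Subset using (Subset; _∈_; _∉_; _⊆_; ∣_∣; ⊤; ⊥; ⁅_⁆; _∪_; _∩_)
open import Data.Fin.Subset.Properties
  using (_∈?_; ∈⊤; ∉⊥; x∈⁅x⁆; x∈⁅y⁆⇒x≡y; ∣⊥∣≡0; ∣⁅x⁆∣≡1; ⊆-refl; ⊆-antisym;
         p⊆q⇒∣p∣≤∣q∣; p⊂q⇒∣p∣<∣q∣; p⊆p∪q; q⊆p∪q; x∈p∪q⁻; x∈p∩q⁺; p∩q⊆p; p∩q⊆q)
open import Data.Fin.Properties using (any?)
open import Data.Product using (∃-syntax; _×_; _,_; proj₁; proj₂)
open import Data.Sum using (_⊎_; inj₁; inj₂; [_,_]′)
import Data.Sum as Sum
open import Data.List using (List; []; _∷_; length; map; filter; allFin)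
open import Data.List.Properties using (length-map)
open import Data.List.Relation.Unary.All as All using (All; []; _∷_)
open import Data.List.Relation.Unary.AllPairs using ([]; _∷_)
open import Data.List.Relation.Unary.Unique.Propositional using (Unique)
import Data.List.Membership.Propositional as List
open import Data.List.Membership.Propositional.Properties using (∈-map⁺; ∈-map⁻; ∈-filter⁺; ∈-filter⁻; ∈-allFin)
open import Data.List.Relation.Unary.Any using (here; there)
open import Relation.Nullary using (¬_; Dec; yes; no; does; contradiction)
open import Relation.Nullary.Decidable using (_×-dec_)
open import Relation.Unary using (Pred; Decidable)
open import Relation.Binary.PropositionalEquality using (_≡_; _≢_; refl; sym; trans; cong; cong₂; subst; module ≡-Reasoning)
open import Level using (0ℓ)

Disjoint : ∀ {n} → Subset n → Subset n → Set
Disjoint p q = ∀ {x} → x ∈ p → x ∉ q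

∣p∪q∣≡∣p∣+∣q∣ : ∀ {n} (p q : Subset n) → Disjoint p q → ∣ p ∪ q ∣ ≡ ∣ p ∣ + ∣ q ∣
∣p∪q∣≡∣p∣+∣q∣ []          []          _    = refl
∣p∪q∣≡∣p∣+∣q∣ (true ∷ p)  (true ∷ q)  p#q  = contradiction here (p#q here)
∣p∪q∣≡∣p∣+∣q∣ (true ∷ p)  (false ∷ q) p#q  =
  cong suc (∣p∪q∣≡∣p∣+∣q∣ p q (λ x∈p x∈q → p#q (there x∈p) (there x∈q)))
∣p∪q∣≡∣p∣+∣q∣ (false ∷ p) (true ∷ q)  p#q  =
  trans (cong suc (∣p∪q∣≡∣p∣+∣q∣ p q (λ x∈p x∈q → p#q (there x∈p) (there x∈q)))) (sym (+-suc (∣ p ∣) (∣ q ∣)))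
∣p∪q∣≡∣p∣+∣q∣ (false ∷ p) (false ∷ q) p#q  =
  ∣p∪q∣≡∣p∣+∣q∣ p q (λ x∈p x∈q → p#q (there x∈p) (there x∈q))

∣p∪q∣≤∣p∣+∣q∣ : ∀ {n} (p q : Subset n) → ∣ p ∪ q ∣ ≤ ∣ p ∣ + ∣ q ∣
∣p∪q∣≤∣p∣+∣q∣ []          []          = z≤n
∣p∪q∣≤∣p∣+∣q∣ (true ∷ p)  (true ∷ q)  =
  s≤s (≤-trans (∣p∪q∣≤∣p∣+∣q∣ p q) (+-monoʳ-≤ ∣ p ∣ (n≤1+n ∣ q ∣)))
∣p∪q∣≤∣p∣+∣q∣ (true ∷ p)  (false ∷ q) = s≤s (∣p∪q∣≤∣p∣+∣q∣ p q)
∣p∪q∣≤∣p∣+∣q∣ (false ∷ p) (true ∷ q)  =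
  subst (suc ∣ p ∪ q ∣ ≤_) (sym (+-suc (∣ p ∣) (∣ q ∣))) (s≤s (∣p∪q∣≤∣p∣+∣q∣ p q))
∣p∪q∣≤∣p∣+∣q∣ (false ∷ p) (false ∷ q) = ∣p∪q∣≤∣p∣+∣q∣ p q

∪-lub : ∀ {n} {p q r : Subset n} → p ⊆ r → q ⊆ r → p ∪ q ⊆ r
∪-lub {p = p} {q} p⊆r q⊆r x∈p∪q = [ p⊆r , q⊆r ]′ (x∈p∪q⁻ p q x∈p∪q)

x∈p⇒⁅x⁆⊆p : ∀ {n} {x : Fin n} {p} → x ∈ p → ⁅ x ⁆ ⊆ p
x∈p⇒⁅x⁆⊆p {x = x} {p} x∈p y∈⁅x⁆ = subst (_∈ p) (sym (x∈⁅y⁆⇒x≡y x y∈⁅x⁆)) x∈p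

∣p∣≡∣p∩q∣+∣p∩r∣ : ∀ {n} (p q r : Subset n) → p ⊆ q ∪ r → Disjoint q r →
                  ∣ p ∣ ≡ ∣ p ∩ q ∣ + ∣ p ∩ r ∣
∣p∣≡∣p∩q∣+∣p∩r∣ p q r p⊆q∪r q#r = begin
  ∣ p ∣                  ≡⟨ cong ∣_∣ p≡p∩q∪p∩r ⟩
  ∣ (p ∩ q) ∪ (p ∩ r) ∣  ≡⟨ ∣p∪q∣≡∣p∣+∣q∣ (p ∩ q) (p ∩ r) p∩q#p∩r ⟩
  ∣ p ∩ q ∣ + ∣ p ∩ r ∣  ∎
  where
  open ≡-Reasoning
  p∩q#p∩r : Disjoint (p ∩ q) (p ∩ r)
  p∩q#p∩r x∈p∩q x∈p∩r = q#r (p∩q⊆q p q x∈p∩q) (p∩q⊆q p r x∈p∩r)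
  p≡p∩q∪p∩r : p ≡ (p ∩ q) ∪ (p ∩ r)
  p≡p∩q∪p∩r = ⊆-antisym
    (λ x∈p → [ (λ x∈q → p⊆p∪q (p ∩ r) (x∈p∩q⁺ (x∈p , x∈q)))
             , (λ x∈r → q⊆p∪q (p ∩ q) (p ∩ r) (x∈p∩q⁺ (x∈p , x∈r))) ]′ (x∈p∪q⁻ q r (p⊆q∪r x∈p)))
    (∪-lub (p∩q⊆p p q) (p∩q⊆p p r))

p⊆q⇒∣p∣≡∣q∣⇒q⊆p : ∀ {n} {p q : Subset n} → p ⊆ q → ∣ p ∣ ≡ ∣ q ∣ → q ⊆ p
p⊆q⇒∣p∣≡∣q∣⇒q⊆p {p = p} p⊆q ∣p∣≡∣q∣ {x} x∈q with x ∈? p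
... | yes x∈p = x∈p
... | no  x∉p = contradiction ∣p∣≡∣q∣ (<⇒≢ (p⊂q⇒∣p∣<∣q∣ (p⊆q , x , x∈q , x∉p)))

fromList : ∀ {n} → List (Fin n) → Subset n
fromList []       = ⊥
fromList (x ∷ xs) = ⁅ x ⁆ ∪ fromList xs

∈-fromList⁺ : ∀ {n} {x : Fin n} {xs} → x List.∈ xs → x ∈ fromList xs
∈-fromList⁺ {x = x} {_ ∷ xs} (here refl) = p⊆p∪q (fromList xs) (x∈⁅x⁆ x)
∈-fromList⁺ {xs = y ∷ _}      (there x∈xs) = q⊆p∪q ⁅ y ⁆ _ (∈-fromList⁺ x∈xs)

∈-fromList⁻ : ∀ {n} {x : Fin n} xs → x ∈ fromList xs → x List.∈ xs
∈-fromList⁻ []       x∈⊥ = contradiction x∈⊥ ∉⊥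
∈-fromList⁻ (y ∷ xs) x∈ with x∈p∪q⁻ ⁅ y ⁆ (fromList xs) x∈
... | inj₁ x∈⁅y⁆ = here (x∈⁅y⁆⇒x≡y y x∈⁅y⁆)
... | inj₂ x∈xs  = there (∈-fromList⁻ xs x∈xs)

∣fromList∣≤length : ∀ {n} (xs : List (Fin n)) → ∣ fromList xs ∣ ≤ length xs
∣fromList∣≤length {n} []  = ≤-reflexive (∣⊥∣≡0 n)
∣fromList∣≤length (x ∷ xs) = ≤-trans (∣p∪q∣≤∣p∣+∣q∣ ⁅ x ⁆ (fromList xs))
  (subst (λ k → k + ∣ fromList xs ∣ ≤ suc (length xs)) (sym (∣⁅x⁆∣≡1 x)) (s≤s (∣fromList∣≤length xs)))

∣fromList∣≡length : ∀ {n} (xs : List (Fin n)) → Unique xs → ∣ fromList xs ∣ ≡ length xs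
∣fromList∣≡length {n} []  _ = ∣⊥∣≡0 n
∣fromList∣≡length (x ∷ xs) (x∉xs ∷ unique) =
  trans (∣p∪q∣≡∣p∣+∣q∣ ⁅ x ⁆ (fromList xs) ⁅x⁆#xs) (cong₂ _+_ (∣⁅x⁆∣≡1 x) (∣fromList∣≡length xs unique))
  where
  ⁅x⁆#xs : Disjoint ⁅ x ⁆ (fromList xs)
  ⁅x⁆#xs y∈⁅x⁆ y∈xs = All.lookup x∉xs (∈-fromList⁻ xs y∈xs) (sym (x∈⁅y⁆⇒x≡y x y∈⁅x⁆))

Unique-map-filter : ∀ {A B : Set} (f : A → B) {P : Pred A 0ℓ} (P? : Decidable P) xs →
                    Unique (map f xs) → Unique (map f (filter P? xs))
Unique-map-filter f P? []       []              = []
Unique-map-filter f P? (x ∷ xs) (fx∉fxs ∷ unique) with does (P? x)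
... | false = Unique-map-filter f P? xs unique
... | true  = All.tabulate fx≢ ∷ Unique-map-filter f P? xs unique
  where
  fx≢ : ∀ {y} → y List.∈ map f (filter P? xs) → f x ≢ y
  fx≢ y∈ with ∈-map⁻ f y∈
  ... | x′ , x′∈ , refl = All.lookup fx∉fxs (∈-map⁺ f (proj₁ (∈-filter⁻ P? x′∈)))

∣fromList-map₂∣≤∣fromList-map₁∣ : ∀ {n} (L : List (Fin n × Fin n)) → Unique (map proj₁ L) →
                                   ∣ fromList (map proj₂ L) ∣ ≤ ∣ fromList (map proj₁ L) ∣
∣fromList-map₂∣≤∣fromList-map₁∣ L unique = begin
  ∣ fromList (map proj₂ L) ∣  ≤⟨ ∣fromList∣≤length (map proj₂ L) ⟩
  length (map proj₂ L)       ≡⟨ length-map proj₂ L ⟩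
  length L                   ≡⟨ sym (length-map proj₁ L) ⟩
  length (map proj₁ L)       ≡⟨ sym (∣fromList∣≡length (map proj₁ L) unique) ⟩
  ∣ fromList (map proj₁ L) ∣  ∎
  where open ≤-Reasoning

module Independence {n : ℕ} (G : Graph n) where

  Adj-sym : ∀ {u v} → Adj G u v → Adj G v u
  Adj-sym {u} {v} uv = trans (adj-sym G v u) uv

  HasNeighbourIn : Subset n → Fin n → Set
  HasNeighbourIn S v = ∃[ u ] (u ∈ S × Adj G v u)

  Dominated : Subset n → Fin n → Set
  Dominated S v = v ∈ S ⊎ HasNeighbourIn S v

  DominatingIn : Subset n → Subset n → Set
  DominatingIn X S = ∀ {v} → v ∈ X → Dominated S v

  hasNeighbourIn? : ∀ S v → Dec (HasNeighbourIn S v)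
  hasNeighbourIn? S v = any? (λ u → (u ∈? S) ×-dec (adj G v u Bool.≟ true))

  Dominated-⊆ : ∀ {S S′ v} → S ⊆ S′ → Dominated S v → Dominated S′ v
  Dominated-⊆ S⊆S′ = Sum.map S⊆S′ (λ (u , u∈S , vu) → u , S⊆S′ u∈S , vu)

  Independent-⊆ : ∀ {S T} → T ⊆ S → Independent G S → Independent G T
  Independent-⊆ T⊆S indS u v u∈T v∈T = indS u v (T⊆S u∈T) (T⊆S v∈T)

  Independent-∪⁅⁆ : ∀ {S v} → Independent G S → ¬ HasNeighbourIn S v → Independent G (S ∪ ⁅ v ⁆)
  Independent-∪⁅⁆ {S} {v} indS no-nb x y x∈ y∈ xy with x∈p∪q⁻ S ⁅ v ⁆ x∈ | x∈p∪q⁻ S ⁅ v ⁆ y∈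
  ... | inj₁ x∈S | inj₁ y∈S = indS x y x∈S y∈S xy
  ... | inj₁ x∈S | inj₂ y∈v rewrite x∈⁅y⁆⇒x≡y v y∈v = no-nb (x , x∈S , Adj-sym xy)
  ... | inj₂ x∈v | inj₁ y∈S rewrite x∈⁅y⁆⇒x≡y v x∈v = no-nb (y , y∈S , xy)
  ... | inj₂ x∈v | inj₂ y∈v rewrite x∈⁅y⁆⇒x≡y v x∈v | x∈⁅y⁆⇒x≡y v y∈v
    = contradiction (trans (sym (irrefl G v)) xy) (λ ())

  independent∧dominating⇒maximal : ∀ {X S} → S ⊆ X → Independent G S → DominatingIn X S →
                                   MaximalIndependentIn G X S
  independent∧dominating⇒maximal {S = S} S⊆X indS dom = S⊆X , indS , λ T S⊆T T⊆X indT →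
    let in-S : ∀ {v} → v ∈ T → Dominated S v → v ∈ S
        in-S {v} v∈T = [ (λ v∈S → v∈S) , (λ (u , u∈S , vu) → contradiction vu (indT v u v∈T (S⊆T u∈S))) ]′
    in ⊆-antisym (λ v∈T → in-S v∈T (dom (T⊆X v∈T))) S⊆T

  maximal⇒dominating : ∀ {X S} → MaximalIndependentIn G X S → DominatingIn X S
  maximal⇒dominating {X} {S} (S⊆X , indS , maxS) {v} v∈X with v ∈? S | hasNeighbourIn? S v
  ... | yes v∈S | _      = inj₁ v∈S
  ... | no _    | yes nb = inj₂ nb
  ... | no v∉S  | no ¬nb = contradiction (subst (v ∈_) S∪v≡S (q⊆p∪q S ⁅ v ⁆ (x∈⁅x⁆ v))) v∉S
    where
    S∪v≡S : S ∪ ⁅ v ⁆ ≡ S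
    S∪v≡S = maxS (S ∪ ⁅ v ⁆) (p⊆p∪q ⁅ v ⁆) (∪-lub S⊆X (x∈p⇒⁅x⁆⊆p v∈X))
                 (Independent-∪⁅⁆ indS ¬nb)

  Extension : Subset n → Subset n → List (Fin n) → Set
  Extension X S vs = ∃[ S′ ] (S ⊆ S′ × S′ ⊆ X × Independent G S′ × All (λ v → v ∈ X → Dominated S′ v) vs)

  extension-cons : ∀ {X S v vs} → (v ∈ X → Dominated S v) → Extension X S vs → Extension X S (v ∷ vs)
  extension-cons dom (S′ , S⊆S′ , S′⊆X , indS′ , doms) =
    S′ , S⊆S′ , S′⊆X , indS′ , (λ v∈X → Dominated-⊆ S⊆S′ (dom v∈X)) ∷ doms

  extension-⊆ : ∀ {X S₀ S vs} → S₀ ⊆ S → Extension X S vs → Extension X S₀ vs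
  extension-⊆ S₀⊆S (S′ , S⊆S′ , rest) = S′ , (λ x∈S₀ → S⊆S′ (S₀⊆S x∈S₀)) , rest

  extension : ∀ X S vs → S ⊆ X → Independent G S → Extension X S vs
  extension X S []       S⊆X indS = S , ⊆-refl , S⊆X , indS , []
  extension X S (v ∷ vs) S⊆X indS with hasNeighbourIn? S v | v ∈? X
  ... | yes nb | _      = extension-cons (λ _ → inj₂ nb) (extension X S vs S⊆X indS)
  ... | no _   | no v∉X = extension-cons (λ v∈X → contradiction v∈X v∉X) (extension X S vs S⊆X indS)
  ... | no ¬nb | yes v∈X = extension-⊆ (p⊆p∪q ⁅ v ⁆)
    (extension-cons (λ _ → inj₁ (q⊆p∪q S ⁅ v ⁆ (x∈⁅x⁆ v)))
      (extension X (S ∪ ⁅ v ⁆) vs (∪-lub S⊆X (x∈p⇒⁅x⁆⊆p v∈X))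
                 (Independent-∪⁅⁆ indS ¬nb)))

  maximal-⊇ : ∀ {X S} → S ⊆ X → Independent G S → ∃[ S′ ] (S ⊆ S′ × MaximalIndependentIn G X S′)
  maximal-⊇ {X} {S} S⊆X indS with extension X S (allFin n) S⊆X indS
  ... | S′ , S⊆S′ , S′⊆X , indS′ , doms =
    S′ , S⊆S′ , independent∧dominating⇒maximal S′⊆X indS′ (λ {v} → All.lookup doms (∈-allFin v))

module Crown {n : ℕ} {G : Graph n} {C H R : Subset n} (cd : CrownDecomposition G C H R) where
  open Independence G
  open CrownDecomposition cd

  C#R : Disjoint C R
  C#R {x} x∈C x∈R with partition x
  ... | inj₁ (_ , _ , x∉R)        = x∉R x∈R
  ... | inj₂ (inj₁ (x∉C , _))     = x∉C x∈C
  ... | inj₂ (inj₂ (x∉C , _))     = x∉C x∈C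

  C#H : Disjoint C H
  C#H {x} x∈C x∈H with partition x
  ... | inj₁ (_ , x∉H , _)        = x∉H x∈H
  ... | inj₂ (inj₁ (x∉C , _))     = x∉C x∈C
  ... | inj₂ (inj₂ (x∉C , _))     = x∉C x∈C

  H#R : Disjoint H R
  H#R {x} x∈H x∈R with partition x
  ... | inj₁ (_ , x∉H , _)        = x∉H x∈H
  ... | inj₂ (inj₁ (_ , _ , x∉R)) = x∉R x∈R
  ... | inj₂ (inj₂ (_ , x∉H , _)) = x∉H x∈H

  C∪H#R : Disjoint (C ∪ H) R
  C∪H#R {x} x∈C∪H = [ C#R , H#R ]′ (x∈p∪q⁻ C H x∈C∪H)

  ⊆C∪H∪R : ∀ {S} → S ⊆ (C ∪ H) ∪ R
  ⊆C∪H∪R {x = x} _ with partition x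
  ... | inj₁ (x∈C , _)             = p⊆p∪q R (p⊆p∪q H x∈C)
  ... | inj₂ (inj₁ (_ , x∈H , _))  = p⊆p∪q R (q⊆p∪q C H x∈H)
  ... | inj₂ (inj₂ (_ , _ , x∈R))  = q⊆p∪q (C ∪ H) R x∈R

  M : List (Fin n × Fin n)
  M = proj₁ matching

  M-edge : ∀ {e} → e List.∈ M → proj₁ e ∈ C × proj₂ e ∈ H × Adj G (proj₁ e) (proj₂ e)
  M-edge = All.lookup (proj₁ (proj₁ (proj₂ matching)))

  M-unique₁ : Unique (map proj₁ M)
  M-unique₁ = proj₁ (proj₂ (proj₁ (proj₂ matching)))

  matched : Subset n
  matched = fromList (map proj₂ M)

  matched⊆H : matched ⊆ H
  matched⊆H h∈ with ∈-map⁻ proj₂ (∈-fromList⁻ (map proj₂ M) h∈)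
  ... | e , e∈M , refl = proj₁ (proj₂ (M-edge e∈M))

  ∣matched∣≡∣H∣ : ∣ matched ∣ ≡ ∣ H ∣
  ∣matched∣≡∣H∣ = begin
    ∣ matched ∣           ≡⟨ ∣fromList∣≡length (map proj₂ M) (proj₂ (proj₂ (proj₁ (proj₂ matching)))) ⟩
    length (map proj₂ M)  ≡⟨ length-map proj₂ M ⟩
    length M              ≡⟨ proj₂ (proj₂ matching) ⟩
    ∣ H ∣                 ∎
    where open ≡-Reasoning

  H-matched : ∀ {h} → h ∈ H → ∃[ e ] (e List.∈ M × proj₂ e ≡ h)
  H-matched h∈H with ∈-map⁻ proj₂ (∈-fromList⁻ (map proj₂ M) (p⊆q⇒∣p∣≡∣q∣⇒q⊆p matched⊆H ∣matched∣≡∣H∣ h∈H))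
  ... | e , e∈M , h≡ = e , e∈M , sym h≡

  H-hasNeighbourIn-C : ∀ {h} → h ∈ H → HasNeighbourIn C h
  H-hasNeighbourIn-C h∈H with H-matched h∈H
  ... | e , e∈M , refl = proj₁ e , proj₁ (M-edge e∈M) , Adj-sym (proj₂ (proj₂ (M-edge e∈M)))

  Independent-C∪ : ∀ {K} → K ⊆ R → Independent G K → Independent G (C ∪ K)
  Independent-C∪ {K} K⊆R indK u v u∈ v∈ uv with x∈p∪q⁻ C K u∈ | x∈p∪q⁻ C K v∈
  ... | inj₁ u∈C | inj₁ v∈C = C-indep u v u∈C v∈C uv
  ... | inj₁ u∈C | inj₂ v∈K = no-C-R-edge u v u∈C (K⊆R v∈K) uv
  ... | inj₂ u∈K | inj₁ v∈C = no-C-R-edge v u v∈C (K⊆R u∈K) (Adj-sym uv)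
  ... | inj₂ u∈K | inj₂ v∈K = indK u v u∈K v∈K uv

  ∣C∪K∣≡∣C∣+∣K∣ : ∀ {K} → K ⊆ R → ∣ C ∪ K ∣ ≡ ∣ C ∣ + ∣ K ∣
  ∣C∪K∣≡∣C∣+∣K∣ {K} K⊆R = ∣p∪q∣≡∣p∣+∣q∣ C K (λ x∈C x∈K → C#R x∈C (K⊆R x∈K))

  maximal-C∪ : ∀ {S} → MaximalIndependentIn G R S → MaximalIndependentIn G ⊤ (C ∪ S)
  maximal-C∪ {S} maxS@(S⊆R , indS , _) =
    independent∧dominating⇒maximal (λ _ → ∈⊤) (Independent-C∪ S⊆R indS) dominating
    where
    dominating : DominatingIn ⊤ (C ∪ S)
    dominating {v} _ with partition v
    ... | inj₁ (v∈C , _)            = inj₁ (p⊆p∪q S v∈C)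
    ... | inj₂ (inj₁ (_ , v∈H , _)) = Dominated-⊆ (p⊆p∪q S) (inj₂ (H-hasNeighbourIn-C v∈H))
    ... | inj₂ (inj₂ (_ , _ , v∈R)) = Dominated-⊆ (q⊆p∪q C S) (maximal⇒dominating maxS v∈R)

  wellCoveredOn-R : WellCovered G → WellCoveredOn G R
  wellCoveredOn-R wc S T maxS maxT = +-cancelˡ-≡ (∣ C ∣) (∣ S ∣) (∣ T ∣) (begin
    ∣ C ∣ + ∣ S ∣  ≡⟨ sym (∣C∪K∣≡∣C∣+∣K∣ (proj₁ maxS)) ⟩
    ∣ C ∪ S ∣      ≡⟨ wc (C ∪ S) (C ∪ T) (maximal-C∪ maxS) (maximal-C∪ maxT) ⟩
    ∣ C ∪ T ∣      ≡⟨ ∣C∪K∣≡∣C∣+∣K∣ (proj₁ maxT) ⟩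
    ∣ C ∣ + ∣ T ∣  ∎)
    where open ≡-Reasoning

  ∣T∣≤∣C∣ : ∀ {T} → T ⊆ C ∪ H → Independent G T → ∣ T ∣ ≤ ∣ C ∣
  ∣T∣≤∣C∣ {T} T⊆C∪H indT = begin
    ∣ T ∣                  ≡⟨ ∣p∣≡∣p∩q∣+∣p∩r∣ T C H T⊆C∪H C#H ⟩
    ∣ T ∩ C ∣ + ∣ T ∩ H ∣  ≤⟨ +-monoʳ-≤ (∣ T ∩ C ∣) ∣T∩H∣≤∣B∣ ⟩
    ∣ T ∩ C ∣ + ∣ B ∣      ≡⟨ sym (∣p∪q∣≡∣p∣+∣q∣ (T ∩ C) B T∩C#B) ⟩
    ∣ (T ∩ C) ∪ B ∣        ≤⟨ p⊆q⇒∣p∣≤∣q∣ (∪-lub (p∩q⊆q T C) (λ x∈B → proj₁ (B⊆C∖T x∈B))) ⟩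
    ∣ C ∣                  ∎
    where
    open ≤-Reasoning
    L : List (Fin n × Fin n)
    L = filter (λ e → proj₂ e ∈? T) M
    B : Subset n
    B = fromList (map proj₁ L)
    ∣T∩H∣≤∣B∣ : ∣ T ∩ H ∣ ≤ ∣ B ∣
    ∣T∩H∣≤∣B∣ = ≤-trans (p⊆q⇒∣p∣≤∣q∣ T∩H⊆)
                        (∣fromList-map₂∣≤∣fromList-map₁∣ L (Unique-map-filter proj₁ _ M M-unique₁))
      where
      T∩H⊆ : T ∩ H ⊆ fromList (map proj₂ L)
      T∩H⊆ x∈T∩H with H-matched (p∩q⊆q T H x∈T∩H)
      ... | e , e∈M , refl = ∈-fromList⁺ (∈-map⁺ proj₂ (∈-filter⁺ (λ e → proj₂ e ∈? T) e∈M (p∩q⊆p T H x∈T∩H)))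
    -- A partner c of some h ∈ T is outside T because T is independent.
    B⊆C∖T : ∀ {c} → c ∈ B → c ∈ C × c ∉ T
    B⊆C∖T c∈B with ∈-map⁻ proj₁ (∈-fromList⁻ (map proj₁ L) c∈B)
    ... | e , e∈L , refl with ∈-filter⁻ (λ e → proj₂ e ∈? T) e∈L
    ... | e∈M , h∈T = proj₁ (M-edge e∈M) , λ c∈T → indT (proj₁ e) (proj₂ e) c∈T h∈T (proj₂ (proj₂ (M-edge e∈M)))
    T∩C#B : Disjoint (T ∩ C) B
    T∩C#B x∈T∩C x∈B = proj₂ (B⊆C∖T x∈B) (p∩q⊆p T C x∈T∩C)

  ∣C∣≤∣T∣ : WellCovered G → ∀ {T} → MaximalIndependentIn G (C ∪ H) T → ∣ C ∣ ≤ ∣ T ∣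
  ∣C∣≤∣T∣ wc {T} (T⊆C∪H , indT , maxT) with maximal-⊇ (λ _ → ∈⊤) indT
  ... | W , T⊆W , maxW@(_ , indW , _)
    with maximal-⊇ (λ _ → ∈⊤) (Independent-C∪ (p∩q⊆q W R) (Independent-⊆ (p∩q⊆p W R) indW))
  ... | W′ , C∪K⊆W′ , maxW′ = +-cancelʳ-≤ (∣ K ∣) (∣ C ∣) (∣ T ∣) (begin
    ∣ C ∣ + ∣ K ∣              ≡⟨ sym (∣C∪K∣≡∣C∣+∣K∣ (p∩q⊆q W R)) ⟩
    ∣ C ∪ K ∣                  ≤⟨ p⊆q⇒∣p∣≤∣q∣ C∪K⊆W′ ⟩
    ∣ W′ ∣                     ≡⟨ wc W′ W maxW′ maxW ⟩
    ∣ W ∣                      ≡⟨ ∣p∣≡∣p∩q∣+∣p∩r∣ W (C ∪ H) R ⊆C∪H∪R C∪H#R ⟩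
    ∣ W ∩ (C ∪ H) ∣ + ∣ K ∣    ≡⟨ cong (λ A → ∣ A ∣ + ∣ K ∣) W∩C∪H≡T ⟩
    ∣ T ∣ + ∣ K ∣              ∎)
    where
    open ≤-Reasoning
    K : Subset n
    K = W ∩ R
    W∩C∪H≡T : W ∩ (C ∪ H) ≡ T
    W∩C∪H≡T = maxT (W ∩ (C ∪ H)) (λ x∈T → x∈p∩q⁺ (T⊆W x∈T , T⊆C∪H x∈T)) (p∩q⊆q W (C ∪ H))
                   (Independent-⊆ (p∩q⊆p W (C ∪ H)) indW)

  wellCoveredOn-C∪H : WellCovered G → WellCoveredOn G (C ∪ H)
  wellCoveredOn-C∪H wc S T maxS maxT = trans (∣S∣≡∣C∣ maxS) (sym (∣S∣≡∣C∣ maxT))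
    where
    ∣S∣≡∣C∣ : ∀ {S} → MaximalIndependentIn G (C ∪ H) S → ∣ S ∣ ≡ ∣ C ∣
    ∣S∣≡∣C∣ maxS@(S⊆C∪H , indS , _) = ≤-antisym (∣T∣≤∣C∣ S⊆C∪H indS) (∣C∣≤∣T∣ wc maxS)

lemma5 : ∀ {n : ℕ} (G : Graph n) (C H R : Subset n) →
    NoIsolatedVertices G → CrownDecomposition G C H R →
    WellCovered G → WellCoveredOn G R × WellCoveredOn G (C ∪ H)
lemma5 G C H R _ cd wc = wellCoveredOn-R wc , wellCoveredOn-C∪H wc
  where open Crown cd
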